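{- Let $G=(V,E)$ be a connected Eulerian digraph and $A$ an acyclic arc set of $G$ having exactly one sink $s$. If a vertex $s'$ is sinkable in $A$, then $\Phi(A,s')$ has exactly one sink, namely $s'$, and $s$ is sinkable in $\Phi(A,s')$. Moreover $A\subseteq\Phi(\Phi(A,s'),s)$.
   Context: Digraphs are finite and simple; Eulerian means in-degree equals out-degree at every vertex. For $A\subseteq E$, $G[A]$ is the digraph $(V,A)$; $A$ is an acyclic arc set if $G[A]$ has no directed cycle. A vertex is a sink of an acyclic arc set $A$ if it has in-degree $0$ in $G[A]$. For a vertex $t$, let $R_A(t)$ be the set of vertices reachable from $t$ by a directed path in $G[A]$ (including $t$). If $A$ has exactly one sink $s$, a vertex $s'\neq s$ is sinkable in $A$ if some arc of $G$ has head $s$ and tail in $R_A(s')$. For $X\subseteq V$ let $\delta^+(X)=\{(u,v)\in E:u\in X,v\notin X\}$ and $\delta^-(X)=\{(u,v)\in E:u\notin X,v\in X\}$. The cut-stretch of $A$ at $t$ is $\Phi(A,t)=(A\setminus\delta^-(R_A(t)))\cup\delta^+(R_A(t))$. -}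

module Defs where

open import Data.Nat using (ℕ; zero; suc; _+_)
open import Data.Bool using (Bool; true; false; if_then_else_)
open import Data.Fin using (Fin)
import Data.Fin as F
open import Data.Product using (_×_; ∃-syntax)
open import Data.Sum using (_⊎_)
open import Relation.Nullary using (¬_; Dec)
open import Relation.Binary.PropositionalEquality using (_≡_)

count : ∀ {n} → (Fin n → Bool) → ℕ
count {zero} f = 0
count {suc n} f = (if f F.zero then 1 else 0) + count (λ i → f (F.suc i))

-- A finite simple digraph on vertex set Fin n: arcs given by a Boolean
-- adjacency relation (so no parallel arcs), with no loops.
record Digraph (n : ℕ) : Set where
  field
    arc   : Fin n → Fin n → Bool
    loopless : ∀ v → arc v v ≡ false

open Digraph public

outdeg indeg : ∀ {n} → Digraph n → Fin n → ℕ
outdeg G v = count (λ w → arc G v w)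
indeg  G v = count (λ u → arc G u v)

Eulerian : ∀ {n} → Digraph n → Set
Eulerian G = ∀ v → indeg G v ≡ outdeg G v

-- Weak connectivity (connectivity of the underlying undirected graph).
data UConn {n} (G : Digraph n) (u : Fin n) : Fin n → Set where
  here : UConn G u u
  fwd  : ∀ {v w} → UConn G u v → arc G v w ≡ true → UConn G u w
  bwd  : ∀ {v w} → UConn G u v → arc G w v ≡ true → UConn G u w

Connected : ∀ {n} → Digraph n → Set
Connected {n} G = ∀ (u v : Fin n) → UConn G u v

ArcSet : ℕ → Set₁
ArcSet n = Fin n → Fin n → Set

SubArcs : ∀ {n} → Digraph n → ArcSet n → Set
SubArcs G A = ∀ u v → A u v → arc G u v ≡ true

-- Reach A t v : v is reachable from t by a directed path in G[A] (v ∈ R_A(t)).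
data Reach {n} (A : ArcSet n) (t : Fin n) : Fin n → Set where
  here : Reach A t t
  step : ∀ {u v} → Reach A t u → A u v → Reach A t v

Acyclic : ∀ {n} → ArcSet n → Set
Acyclic {n} A = ∀ (u v : Fin n) → A u v → ¬ Reach A v u

IsSink : ∀ {n} → ArcSet n → Fin n → Set
IsSink {n} A v = ∀ (u : Fin n) → ¬ A u v

UniqueSink : ∀ {n} → ArcSet n → Fin n → Set
UniqueSink {n} A s = IsSink A s × (∀ (v : Fin n) → IsSink A v → v ≡ s)

Sinkable : ∀ {n} → Digraph n → ArcSet n → Fin n → Fin n → Set
Sinkable G A s s' = ¬ (s' ≡ s) × ∃[ u ] (Reach A s' u × arc G u s ≡ true)

-- Cut-stretch Φ(A,t) = (A ∖ δ⁻(R_A(t))) ∪ δ⁺(R_A(t)).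
Φ : ∀ {n} → Digraph n → ArcSet n → Fin n → ArcSet n
Φ G A t u v =
  (A u v × ¬ (arc G u v ≡ true × ¬ Reach A t u × Reach A t v))
  ⊎ (arc G u v ≡ true × Reach A t u × ¬ Reach A t v)

_⊆ₐ_ : ∀ {n} → ArcSet n → ArcSet n → Set
_⊆ₐ_ {n} A B = ∀ (u v : Fin n) → A u v → B u v

module Submission where

-- Write R = R_A(t) for the set reached from t and B = Φ(A,t).
-- Because R is closed under A-arcs, an arc of A survives in B unless it
-- enters R, and B adds exactly the G-arcs leaving R.  Hence t is a sink of B,
-- a vertex of R other than t keeps its incoming path arc, and a vertex
-- outside R is a sink of B only if it was a sink of A, i.e. it is s — but s
-- receives a new arc from R because t is sinkable.  Outside R nothing
-- changes, so the A-paths from s (which reach every vertex, as s is the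
-- unique sink of a finite acyclic arc set) that end outside R survive in B,
-- while R stays unreachable from s in B: R_B(s) is exactly the complement of
-- R.  This yields the sinkable witness for s and, comparing the two cuts,
-- A ⊆ Φ(B,s).

open import Defs
open import Data.Nat using (ℕ)
open import Data.Fin using (Fin)
open import Data.Product using (_×_)
open import Relation.Nullary using (Dec)

open import Data.Nat using (zero; suc; _+_; _∸_; _≤_; _<_; s≤s)
open import Data.Nat.Properties using (+-suc; ≤-trans; ≤-pred; m≤n+m; m∸n+n≡m; n<1+n)
open import Data.Fin using (toℕ)
open import Data.Fin.Properties using (pigeonhole; toℕ<n; _≟_; any?)
open import Data.Product using (∃-syntax; _,_; proj₁; proj₂)
open import Data.Sum using (inj₁; inj₂)
open import Data.Empty using (⊥-elim)
open import Function using (_∘_)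
open import Induction.WellFounded using (Acc; acc; WellFounded)
open import Relation.Nullary using (¬_; yes; no)
open import Relation.Nullary.Decidable using (map′)
open import Relation.Binary.PropositionalEquality using (_≡_; refl; sym; subst)

record BackWalk {n : ℕ} (A : ArcSet n) (k : ℕ) (v : Fin n) : Set where
  field
    vertex : ℕ → Fin n
    starts : vertex 0 ≡ v
    arcs   : ∀ i → i < k → A (vertex (suc i)) (vertex i)

module _ {n : ℕ} {A : ArcSet n} where

  stay : ∀ v → BackWalk A 0 v
  stay v = record { vertex = λ _ → v ; starts = refl ; arcs = λ _ () }

  extend : ∀ {k u v} → A u v → BackWalk A k u → BackWalk A (suc k) v
  extend {k} {u} {v} a w = record { vertex = vertex′ ; starts = refl ; arcs = arcs′ }
    where
    open BackWalk w
    vertex′ : ℕ → Fin n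
    vertex′ zero    = v
    vertex′ (suc i) = vertex i
    arcs′ : ∀ i → i < suc k → A (vertex′ (suc i)) (vertex′ i)
    arcs′ zero    _         = subst (λ x → A x v) (sym starts) a
    arcs′ (suc i) (s≤s i<k) = arcs i i<k

  module _ {k : ℕ} {v : Fin n} (w : BackWalk A k v) where
    open BackWalk w

    walk-reach : ∀ d i → d + i ≤ k → Reach A (vertex (d + i)) (vertex i)
    walk-reach zero    i _  = here
    walk-reach (suc d) i le =
      step (subst (λ x → Reach A (vertex x) (vertex (suc i))) (+-suc d i)
                  (walk-reach d (suc i) (subst (_≤ k) (sym (+-suc d i)) le)))
           (arcs i (≤-trans (s≤s (m≤n+m i d)) le))

    walk-reach≤ : ∀ {i j} → i < j → j ≤ k → Reach A (vertex j) (vertex (suc i))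
    walk-reach≤ {i} {j} i<j j≤k =
      subst (λ x → Reach A (vertex x) (vertex (suc i))) (m∸n+n≡m i<j)
            (walk-reach (j ∸ suc i) (suc i) (subst (_≤ k) (sym (m∸n+n≡m i<j)) j≤k))

  -- In an acyclic arc set on n vertices there is no backward walk of
  -- length n: two of its n+1 vertices coincide, closing a directed cycle.
  no-long-walk : Acyclic A → ∀ {v} → ¬ BackWalk A n v
  no-long-walk acyc w with pigeonhole (n<1+n n) (BackWalk.vertex w ∘ toℕ)
  ... | i , j , i<j , same =
    acyc (vertex (suc (toℕ i))) (vertex (toℕ i)) (arcs (toℕ i) (≤-trans i<j j≤n))
         (subst (λ x → Reach A x (vertex (suc (toℕ i)))) (sym same)
                (walk-reach≤ w i<j j≤n))
    where
    open BackWalk w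
    j≤n : toℕ j ≤ n
    j≤n = ≤-pred (toℕ<n j)

  -- A finite acyclic arc set is well founded as the relation "u is an
  -- in-neighbour of v": a vertex without long backward walks is accessible.
  acyclic⇒wellFounded : Acyclic A → WellFounded A
  acyclic⇒wellFounded acyc v = accessible n v (no-long-walk acyc)
    where
    accessible : ∀ k v → ¬ BackWalk A k v → Acc A v
    accessible zero    v none = ⊥-elim (none (stay v))
    accessible (suc k) v none = acc λ {u} a → accessible k u (none ∘ extend a)

  in-neighbour : (∀ u v → Dec (A u v)) → ∀ {v} → ¬ IsSink A v → ∃[ u ] A u v
  in-neighbour A? {v} not-sink with any? (λ u → A? u v)
  ... | yes found = found
  ... | no  none  = ⊥-elim (not-sink (λ u a → none (u , a)))

  module _ (A? : ∀ u v → Dec (A u v)) (wf : WellFounded A) where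

    -- Reachability in a decidable well-founded arc set is decidable:
    -- v is reached from t iff v = t or some in-neighbour of v is.
    reach? : ∀ t v → Dec (Reach A t v)
    reach? t v = decide v (wf v)
      where
      decide : ∀ v → Acc A v → Dec (Reach A t v)
      decide v (acc rec) with v ≟ t
      ... | yes refl = yes here
      ... | no  v≢t  = map′ (λ (u , a , r) → step r a) last-arc (any? via)
        where
        via : ∀ u → Dec (A u v × Reach A t u)
        via u with A? u v
        ... | yes a  = map′ (a ,_) proj₂ (decide u (rec a))
        ... | no  ¬a = no (¬a ∘ proj₁)
        last-arc : Reach A t v → ∃[ u ] (A u v × Reach A t u)
        last-arc here       = ⊥-elim (v≢t refl)
        last-arc (step r a) = _ , a , r

    -- The unique sink of a well-founded arc set reaches every vertex:
    -- walking backwards along in-arcs must stop, and only at the sink.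
    reach-from-unique-sink : ∀ {s} → UniqueSink A s → ∀ v → Reach A s v
    reach-from-unique-sink {s} (_ , unique) v = go v (wf v)
      where
      go : ∀ v → Acc A v → Reach A s v
      go v (acc rec) with any? (λ u → A? u v)
      ... | yes (u , a) = step (go u (rec a)) a
      ... | no  none    = subst (Reach A s) (sym (unique v (λ u a → none (u , a)))) here

sink-unreachable : ∀ {n} {A : ArcSet n} {s t} → IsSink A s → ¬ t ≡ s → ¬ Reach A t s
sink-unreachable _    t≢s here       = t≢s refl
sink-unreachable sink _   (step _ a) = sink _ a

Φ-keep : ∀ {n} (G : Digraph n) (A : ArcSet n) (t : Fin n) {u v} →
         A u v → (¬ Reach A t u → ¬ Reach A t v) → Φ G A t u v
Φ-keep G A t a stays-out = inj₁ (a , λ (_ , ¬ru , rv) → stays-out ¬ru rv)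

module CutStretch {n : ℕ} (G : Digraph n) (A : ArcSet n) (t : Fin n) where

  keep : ∀ {u v} → A u v → (¬ Reach A t u → ¬ Reach A t v) → Φ G A t u v
  keep = Φ-keep G A t

  module _ (sub : SubArcs G A) where

    -- t is a sink of Φ(A,t): A-arcs into t enter R_A(t) by acyclicity,
    -- and the new arcs leave R_A(t).
    t-sink : Acyclic A → IsSink (Φ G A t) t
    t-sink acyc u (inj₁ (a , kept))   = kept (sub u t a , acyc u t a , here)
    t-sink _    u (inj₂ (_ , _ , ¬rt)) = ¬rt here

    -- Outside R_A(t), A-paths survive in Φ(A,t) (R_A(t) is closed under A,
    -- so such a path never touches it).
    lift-outside : ∀ {x v} → Reach A x v → ¬ Reach A t v → Reach (Φ G A t) x v
    lift-outside here       _   = here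
    lift-outside (step r a) ¬rv =
      step (lift-outside r (λ ru → ¬rv (step ru a))) (keep a (λ _ → ¬rv))

    -- No arc of Φ(A,t) enters R_A(t), so its complement is closed in Φ(A,t).
    stay-outside : ∀ {x v} → ¬ Reach A t x → Reach (Φ G A t) x v → ¬ Reach A t v
    stay-outside ¬rx here = ¬rx
    stay-outside ¬rx (step r (inj₁ (a , kept))) rv =
      kept (sub _ _ a , stay-outside ¬rx r , rv)
    stay-outside ¬rx (step r (inj₂ (_ , ru , _))) _ = stay-outside ¬rx r ru

    module _ (R? : ∀ v → Dec (Reach A t v)) {s : Fin n} where

      -- If t is sinkable in A with unique sink s, then t is the unique sink
      -- of Φ(A,t): a reached vertex ≠ t keeps its last path arc, an
      -- unreached sink would be s, which receives an arc from R_A(t).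
      unique-sink : Acyclic A → UniqueSink A s → Sinkable G A s t →
                    UniqueSink (Φ G A t) t
      unique-sink acyc (_ , unique) (_ , u₀ , ru₀ , arc₀) = t-sink acyc , only-t
        where
        only-t : ∀ v → IsSink (Φ G A t) v → v ≡ t
        only-t v sink with R? v
        ... | yes here         = refl
        ... | yes (step ru a)  = ⊥-elim (sink _ (keep a (λ ¬ru → ⊥-elim (¬ru ru))))
        ... | no  ¬rv with unique v (λ u a → sink u (keep a (λ _ → ¬rv)))
        ...   | refl = ⊥-elim (sink u₀ (inj₂ (arc₀ , ru₀ , ¬rv)))

      module _ (from-s : ∀ v → Reach A s v) (¬rs : ¬ Reach A t s) where

        -- s is sinkable in Φ(A,t): an in-neighbour w of t lies outside
        -- R_A(t), and the A-path from s to w survives.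
        sinkable-back : Acyclic A → ¬ s ≡ t → ∃[ w ] A w t → Sinkable G (Φ G A t) t s
        sinkable-back acyc s≢t (w , a) =
          s≢t , w , lift-outside (from-s w) (acyc w t a) , sub w t a

        -- Φ(Φ(A,t),s) contains A: R_{Φ(A,t)}(s) is the complement of
        -- R_A(t), so arcs not entering R_A(t) are kept twice, and arcs
        -- entering it leave R_{Φ(A,t)}(s) and are added back.
        restore : A ⊆ₐ Φ G (Φ G A t) s
        restore u v a with R? u | R? v
        ... | yes ru | _ =
          Φ-keep G (Φ G A t) s (keep a (λ ¬ru → ⊥-elim (¬ru ru)))
                          (λ _ r′v → stay-outside ¬rs r′v (step ru a))
        ... | no ¬ru | yes rv =
          inj₂ (sub u v a , lift-outside (from-s u) ¬ru , λ r′v → stay-outside ¬rs r′v rv)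
        ... | no ¬ru | no ¬rv =
          Φ-keep G (Φ G A t) s (keep a (λ _ → ¬rv))
                          (λ ¬r′u → ⊥-elim (¬r′u (lift-outside (from-s u) ¬ru)))

lemma3 : ∀ {n : ℕ} (G : Digraph n) → Connected G → Eulerian G →
    (A : ArcSet n) → (∀ u v → Dec (A u v)) → SubArcs G A → Acyclic A →
    (s s' : Fin n) → UniqueSink A s → Sinkable G A s s' →
    (UniqueSink (Φ G A s') s' × Sinkable G (Φ G A s') s' s)
    × (A ⊆ₐ Φ G (Φ G A s') s)
lemma3 G _ _ A A? sub acyc s s' unique-s sinkable@(s'≢s , _) =
  ( unique-sink sub reached? acyc unique-s sinkable
  , sinkable-back sub reached? from-s ¬rs acyc (s'≢s ∘ sym) in-arc )
  , restore sub reached? from-s ¬rs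
  where
  open CutStretch G A s'
  wf : WellFounded A
  wf = acyclic⇒wellFounded acyc
  reached? : ∀ v → Dec (Reach A s' v)
  reached? = reach? A? wf s'
  from-s : ∀ v → Reach A s v
  from-s = reach-from-unique-sink A? wf unique-s
  ¬rs : ¬ Reach A s' s
  ¬rs = sink-unreachable (proj₁ unique-s) s'≢s
  in-arc : ∃[ w ] A w s'
  in-arc = in-neighbour A? (s'≢s ∘ proj₂ unique-s s')
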